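{- Let $n$ be an odd positive integer and let $\sigma \in B_n(123)$. Then either $\sigma(n)=1$ or $\sigma(n-2)=1$.
   Context: A permutation $\sigma\in S_n$ is written as the sequence $\sigma(1)\cdots\sigma(n)$. An index $i\in[n-1]$ is an ascent if $\sigma(i)<\sigma(i+1)$ and a descent if $\sigma(i)>\sigma(i+1)$. A ballot permutation is a permutation $\sigma$ such that every prefix $\sigma(1)\cdots\sigma(p)$ has at least as many ascents as descents. $\sigma$ contains a pattern $\pi\in S_k$ if some subsequence $\sigma(c_1)\cdots\sigma(c_k)$ with $c_1<\dots<c_k$ is order-isomorphic to $\pi$, and avoids $\pi$ otherwise. $B_n(\pi_1,\dots,\pi_m)$ denotes the set of ballot permutations of length $n$ avoiding all of $\pi_1,\dots,\pi_m$. -}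

module Defs where

open import Data.Nat using (ℕ; zero; suc; _+_; _<_; _≤_)
open import Data.Nat.Properties using (_<?_)
open import Data.Fin using (Fin; toℕ)
open import Data.Fin.Permutation using (Permutation′; _⟨$⟩ʳ_)
open import Data.Product using (Σ; _×_)
open import Relation.Nullary using (¬_; does)
open import Data.Bool using (if_then_else_)

-- A permutation of length n: a bijection of Fin n (0-based positions and
-- values; position i / value v here correspond to i+1 / v+1 in the paper).
Perm : ℕ → Set
Perm n = Permutation′ n

_⟦_⟧ : ∀ {n} → Perm n → Fin n → Fin n
σ ⟦ i ⟧ = σ ⟨$⟩ʳ i

-- Extend σ to ℕ-indexed values (positions ≥ n are never used below).
val : ∀ {n} → Perm n → ℕ → ℕ
val {zero} σ i = 0
val {suc n} σ i with i <? suc n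
... | Relation.Nullary.yes i<n = toℕ (σ ⟦ Data.Fin.fromℕ< i<n ⟧)
... | Relation.Nullary.no _ = 0

ascentsBelow : ∀ {n} → Perm n → ℕ → ℕ
ascentsBelow σ zero = 0
ascentsBelow σ (suc i) =
  (if does (val σ i <? val σ (suc i)) then 1 else 0) + ascentsBelow σ i

descentsBelow : ∀ {n} → Perm n → ℕ → ℕ
descentsBelow σ zero = 0
descentsBelow σ (suc i) =
  (if does (val σ (suc i) <? val σ i) then 1 else 0) + descentsBelow σ i

-- Ballot: every prefix σ(1)…σ(p) (1 ≤ p ≤ n) has at least as many ascents
-- as descents.  The ascents/descents of that prefix are at 0-based indices
-- i < p - 1, i.e. the counts below p-1; we quantify over p = suc q.
IsBallot : ∀ {n} → Perm n → Set
IsBallot {n} σ = ∀ q → suc q ≤ n → descentsBelow σ q ≤ ascentsBelow σ q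

Contains123 : ∀ {n} → Perm n → Set
Contains123 {n} σ = Σ (Fin n) λ a → Σ (Fin n) λ b → Σ (Fin n) λ c →
  (toℕ a < toℕ b) × (toℕ b < toℕ c) ×
  (toℕ (σ ⟦ a ⟧) < toℕ (σ ⟦ b ⟧)) × (toℕ (σ ⟦ b ⟧) < toℕ (σ ⟦ c ⟧))

Avoids123 : ∀ {n} → Perm n → Set
Avoids123 σ = ¬ Contains123 σ

InB123 : ∀ {n} → Perm n → Set
InB123 σ = IsBallot σ × Avoids123 σ

-- A ballot permutation avoiding 123 alternates ascent, descent, ascent, …:
-- at every even (0-based) index 2j the prefix so far has j ascents and j
-- descents, so the ballot condition forces an ascent there, and an ascent at
-- 2j+1 would complete a 123.  Hence the value 1 cannot sit at an odd index
-- (a peak), and if it sat at an even index 2j with 2j+3 still inside σ, it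
-- would form a 123 with the ascent at 2j+2.  So 1 is at an even index among
-- the last three, which for odd n means position n or n-2.
module Submission where

open import Defs
open import Data.Bool using (if_then_else_)
open import Data.Empty using (⊥-elim)
open import Data.Fin as Fin using (toℕ; fromℕ<)
open import Data.Fin.Properties using (toℕ-fromℕ<; fromℕ<-toℕ; toℕ-injective; toℕ<n)
open import Data.Fin.Permutation using (_⟨$⟩ˡ_; inverseˡ; inverseʳ)
open import Data.Nat using (ℕ; zero; suc; _+_; _*_; _∸_; _≤_; _<_; z≤n; s≤s)
open import Data.Nat.Properties
open import Data.Product using (Σ-syntax; _×_; _,_; proj₁; proj₂)
open import Data.Sum using (_⊎_; inj₁; inj₂)
open import Relation.Binary using (tri<; tri≈; tri>)
open import Relation.Binary.PropositionalEquality
  using (_≡_; _≢_; refl; sym; trans; cong; cong₂; subst; subst₂; module ≡-Reasoning)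
open import Relation.Nullary using (¬_; yes; no; does)
open import Relation.Nullary.Decidable using (dec-true; dec-false)

indicator-< : ∀ {x y} → x < y → (if does (x <? y) then 1 else 0) ≡ 1
indicator-< {x} {y} x<y rewrite dec-true (x <? y) x<y = refl

indicator-≮ : ∀ {x y} → ¬ x < y → (if does (x <? y) then 1 else 0) ≡ 0
indicator-≮ {x} {y} x≮y rewrite dec-false (x <? y) x≮y = refl

even-or-odd : ∀ p → Σ[ j ∈ ℕ ] (p ≡ 2 * j ⊎ p ≡ suc (2 * j))
even-or-odd zero = 0 , inj₁ refl
even-or-odd (suc p) with even-or-odd p
... | j , inj₁ p≡2j = j , inj₂ (cong suc p≡2j)
... | j , inj₂ p≡2j+1 = suc j , inj₁ (trans (cong suc p≡2j+1) (sym (*-suc 2 j)))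

module _ {m : ℕ} (σ : Perm (suc m)) where

  val-fromℕ< : ∀ {i} (i<n : i < suc m) → val σ i ≡ toℕ (σ ⟦ fromℕ< i<n ⟧)
  val-fromℕ< {i} i<n with i <? suc m
  ... | yes _ = refl
  ... | no i≮n = ⊥-elim (i≮n i<n)

  val-injective : ∀ {i j} → i < suc m → j < suc m → val σ i ≡ val σ j → i ≡ j
  val-injective i<n j<n vi≡vj = begin
      _                               ≡⟨ sym (toℕ-fromℕ< i<n) ⟩
      toℕ (fromℕ< i<n)                ≡⟨ cong toℕ (sym (inverseˡ σ)) ⟩
      toℕ (σ ⟨$⟩ˡ (σ ⟦ fromℕ< i<n ⟧)) ≡⟨ cong (λ v → toℕ (σ ⟨$⟩ˡ v)) σi≡σj ⟩
      toℕ (σ ⟨$⟩ˡ (σ ⟦ fromℕ< j<n ⟧)) ≡⟨ cong toℕ (inverseˡ σ) ⟩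
      toℕ (fromℕ< j<n)                ≡⟨ toℕ-fromℕ< j<n ⟩
      _                               ∎
    where
    open ≡-Reasoning
    σi≡σj : σ ⟦ fromℕ< i<n ⟧ ≡ σ ⟦ fromℕ< j<n ⟧
    σi≡σj = toℕ-injective (trans (sym (val-fromℕ< i<n)) (trans vi≡vj (val-fromℕ< j<n)))

  val-minimum : Σ[ p ∈ ℕ ] (p < suc m × val σ p ≡ 0)
  val-minimum = toℕ p , toℕ<n p , (begin
      val σ (toℕ p)                ≡⟨ val-fromℕ< (toℕ<n p) ⟩
      toℕ (σ ⟦ fromℕ< (toℕ<n p) ⟧) ≡⟨ cong (λ i → toℕ (σ ⟦ i ⟧)) (fromℕ<-toℕ p (toℕ<n p)) ⟩
      toℕ (σ ⟦ p ⟧)                ≡⟨ cong toℕ (inverseʳ σ) ⟩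
      0                            ∎)
    where
    open ≡-Reasoning
    p = σ ⟨$⟩ˡ Fin.zero

  val-minimum-< : ∀ {p i} → p < suc m → i < suc m → val σ p ≡ 0 → p ≢ i → val σ p < val σ i
  val-minimum-< p<n i<n vp≡0 p≢i = subst (_< _) (sym vp≡0)
    (n≢0⇒n>0 (λ vi≡0 → p≢i (val-injective p<n i<n (trans vp≡0 (sym vi≡0)))))

  ≮⇒descent : ∀ {i} → suc i < suc m → ¬ val σ i < val σ (suc i) → val σ (suc i) < val σ i
  ≮⇒descent {i} i+1<n v≮ with <-cmp (val σ i) (val σ (suc i))
  ... | tri< v< _ _ = ⊥-elim (v≮ v<)
  ... | tri≈ _ v≡ _ = ⊥-elim (1+n≢n (sym (val-injective (<-trans (n<1+n i) i+1<n) i+1<n v≡)))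
  ... | tri> _ _ v> = v>

  avoids123⇒¬123 : Avoids123 σ → ∀ {a b c} → a < b → b < c → c < suc m →
                   val σ a < val σ b → ¬ val σ b < val σ c
  avoids123⇒¬123 avoids {a} {b} {c} a<b b<c c<n va<vb vb<vc =
    avoids (fromℕ< a<n , fromℕ< b<n , fromℕ< c<n
           , subst₂ _<_ (sym (toℕ-fromℕ< a<n)) (sym (toℕ-fromℕ< b<n)) a<b
           , subst₂ _<_ (sym (toℕ-fromℕ< b<n)) (sym (toℕ-fromℕ< c<n)) b<c
           , subst₂ _<_ (val-fromℕ< a<n) (val-fromℕ< b<n) va<vb
           , subst₂ _<_ (val-fromℕ< b<n) (val-fromℕ< c<n) vb<vc)
    where
    b<n = <-trans b<c c<n
    a<n = <-trans a<b b<n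

module Alternation {m : ℕ} (σ : Perm (suc m)) (ballot : IsBallot σ) (avoids : Avoids123 σ) where

  counts-at-even : ∀ j → 2 * j ≤ m → ascentsBelow σ (2 * j) ≡ j × descentsBelow σ (2 * j) ≡ j
  ascent-at-even : ∀ j → suc (2 * j) ≤ m → val σ (2 * j) < val σ (suc (2 * j))
  descent-at-odd : ∀ j → suc (suc (2 * j)) ≤ m → val σ (suc (suc (2 * j))) < val σ (suc (2 * j))

  counts-at-even zero _ = refl , refl
  counts-at-even (suc j) 2[j+1]≤m =
    subst (λ i → ascentsBelow σ i ≡ suc j × descentsBelow σ i ≡ suc j) (sym (*-suc 2 j))
      ( cong₂ _+_ (indicator-≮ (<-asym down)) (cong₂ _+_ (indicator-< up) ascents≡j)
      , cong₂ _+_ (indicator-< down) (cong₂ _+_ (indicator-≮ (<-asym up)) descents≡j))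
    where
    2j+2≤m = subst (_≤ m) (*-suc 2 j) 2[j+1]≤m
    up = ascent-at-even j (≤-trans (n≤1+n _) 2j+2≤m)
    down = descent-at-odd j 2j+2≤m
    counts = counts-at-even j (≤-trans (≤-trans (n≤1+n _) (n≤1+n _)) 2j+2≤m)
    ascents≡j = proj₁ counts
    descents≡j = proj₂ counts

  ascent-at-even j 2j+1≤m with val σ (2 * j) <? val σ (suc (2 * j))
  ... | yes up = up
  ... | no ¬up = ⊥-elim (1+n≰n (subst₂ _≤_
          (cong₂ _+_ (indicator-< (≮⇒descent σ (s≤s 2j+1≤m) ¬up)) descents≡j)
          (cong₂ _+_ (indicator-≮ ¬up) ascents≡j)
          (ballot (suc (2 * j)) (s≤s 2j+1≤m))))
    where
    ascents≡j = proj₁ (counts-at-even j (≤-trans (n≤1+n _) 2j+1≤m))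
    descents≡j = proj₂ (counts-at-even j (≤-trans (n≤1+n _) 2j+1≤m))

  descent-at-odd j 2j+2≤m with val σ (suc (2 * j)) <? val σ (suc (suc (2 * j)))
  ... | yes up = ⊥-elim (avoids123⇒¬123 σ avoids (n<1+n _) (n<1+n _) (s≤s 2j+2≤m)
                           (ascent-at-even j (≤-trans (n≤1+n _) 2j+2≤m)) up)
  ... | no ¬up = ≮⇒descent σ (s≤s 2j+2≤m) ¬up

  minimum-near-end : Σ[ j ∈ ℕ ] (val σ (2 * j) ≡ 0 × 2 * j ≤ m × m ≤ suc (suc (2 * j)))
  minimum-near-end with val-minimum σ
  ... | p , p<n , vp≡0 with even-or-odd p
  ... | j , inj₂ refl =
    ⊥-elim (n≮0 (subst (val σ (2 * j) <_) vp≡0 (ascent-at-even j (≤-pred p<n))))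
  ... | j , inj₁ refl with suc (suc (suc (2 * j))) ≤? m
  ... | no 2j+3≰m = j , vp≡0 , ≤-pred p<n , ≤-pred (≰⇒> 2j+3≰m)
  ... | yes 2j+3≤m = ⊥-elim (avoids123⇒¬123 σ avoids
          (≤-trans (n<1+n _) (n≤1+n _)) (n<1+n _) (s≤s 2j+3≤m)
          (val-minimum-< σ p<n (s≤s (≤-trans (n≤1+n _) 2j+3≤m)) vp≡0 (m≢1+n+m _ {1}))
          up)
    where
    up : val σ (suc (suc (2 * j))) < val σ (suc (suc (suc (2 * j))))
    up = subst (λ i → val σ i < val σ (suc i)) (*-suc 2 j)
           (ascent-at-even (suc j) (subst (λ i → suc i ≤ m) (sym (*-suc 2 j)) 2j+3≤m))

lemma3p1 : (k : ℕ) (σ : Perm (suc (2 * k))) → InB123 σ →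
    (val σ (2 * k) ≡ 0) ⊎ ((1 ≤ k) × (val σ (2 * k ∸ 2) ≡ 0))
lemma3p1 k σ (ballot , avoids) with Alternation.minimum-near-end σ ballot avoids
... | j , v2j≡0 , 2j≤2k , 2k≤2j+2 with m≤n⇒m<n∨m≡n j≤k
  where
  j≤k : j ≤ k
  j≤k = *-cancelˡ-≤ 2 2j≤2k
... | inj₂ refl = inj₁ v2j≡0
... | inj₁ j<k with ≤-antisym j<k k≤1+j
  where
  k≤1+j : k ≤ suc j
  k≤1+j = *-cancelˡ-≤ 2 (subst (2 * k ≤_) (sym (*-suc 2 j)) 2k≤2j+2)
... | refl = inj₂ (s≤s z≤n , subst (λ i → val σ (i ∸ 2) ≡ 0) (sym (*-suc 2 j)) v2j≡0)
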